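{- Let $n$ be an odd positive integer. Assume that one of the following holds: (i) $\gcd\left(\frac{n-1}{2},\varphi(n)\right)$ is odd; (ii) $\gcd\left(\frac{n-1}{2},\lambda(n)\right)$ is odd. Then $n\in\mathfrak{P}$.
   Context: $\varphi$ is Euler's totient function and $\lambda$ is the Carmichael function (the exponent of the multiplicative group $(\mathbb{Z}/n\mathbb{Z})^\times$). For an odd positive integer $n$, put $G(n)=\sum_{j=1}^{n-1} j^{(n-1)/2}$. Let $\mathfrak{P}$ denote the set of odd positive integers $n$ such that $G(n)\equiv 0\pmod n$. -}

module Defs where

open import Data.Nat using (ℕ; zero; suc; _+_; _*_; _∸_; _^_; _≤_; _<_; NonZero)
open import Data.Nat.DivMod using (_%_; _/_)
open import Data.Nat.GCD using (gcd)
open import Data.Nat.Divisibility using (_∣_)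
open import Data.List using (List; map; filter; length; drop)
open import Data.Nat.ListAction using (sum)
open import Data.List.Base using (upTo)
open import Data.Nat.Properties using (_≟_)
open import Relation.Binary.PropositionalEquality using (_≡_)
open import Data.Product using (_×_)
open import Data.Nat.Coprimality using (Coprime)

Odd : ℕ → Set
Odd n = n % 2 ≡ 1

φ : ℕ → ℕ
φ n = length (filter (λ k → gcd (suc k) n ≟ 1) (upTo n))

-- m is the Carmichael value λ(n), i.e. the exponent of (ℤ/nℤ)^× :
-- the least m ≥ 1 with a^m ≡ 1 (mod n) for every a coprime to n.
AnnihilatesUnits : ℕ → ℕ → Set
AnnihilatesUnits n m = ∀ a → Coprime a n → n ∣ (a ^ m ∸ 1)

IsCarmichaelλ : ℕ → ℕ → Set
IsCarmichaelλ n m =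
  1 ≤ m × AnnihilatesUnits n m × (∀ k → 1 ≤ k → AnnihilatesUnits n k → m ≤ k)

G : ℕ → ℕ
G n = sum (map (λ j → j ^ ((n ∸ 1) / 2)) (drop 1 (upTo n)))

InP : ℕ → Set
InP n = 1 ≤ n × Odd n × (n ∣ G n)

module Submission where

-- Write n = 2k + 1, so k = (n - 1)/2 and
--   G(n) = Σ_{j=1}^{n-1} j^k.
-- If k is odd, the terms pair up as j^k + (n - j)^k, and each pair is
-- divisible by j + (n - j) = n because a + b ∣ a^k + b^k for odd k; hence
-- n ∣ G(n).  It remains to see that either hypothesis forces k to be odd
-- (when n ≥ 3; for n = 1 the sum is empty).  Both φ(n) and every exponent
-- annihilating (ℤ/nℤ)^× are even for n ≥ 3: the units pair up as j and n - j
-- (gcd(j, n) = gcd(n - j, n)), and (-1)^m ≡ 1 (mod n) forces m even.  An odd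
-- gcd of k with an even number makes k odd.

open import Defs
open import Data.Nat using (ℕ; zero; suc; _+_; _*_; _∸_; _^_; _≤_; _<_; z≤n; s≤s; _/_; >-nonZero)
open import Data.Nat.Properties
open import Data.Nat.Divisibility
open import Data.Nat.DivMod using (m*n/n≡m)
open import Data.Nat.GCD using (gcd; gcd-greatest; gcd[m,n]∣m; gcd[m,n]∣n)
open import Data.Nat.Coprimality using (Coprime)
open import Data.Nat.ListAction using (sum)
open import Data.List using (map; filter; length; applyUpTo)
open import Data.Bool using (true; false; if_then_else_)
open import Data.Product using (_×_; ∃; _,_)
open import Data.Sum using (_⊎_; inj₁; inj₂)
open import Data.Empty using (⊥-elim)
open import Relation.Nullary using (does; ¬_)
open import Relation.Binary.PropositionalEquality
open import Data.Nat.Solver using (module +-*-Solver)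

OddWitness : ℕ → Set
OddWitness k = ∃ λ t → k ≡ suc (t * 2)

Σ : (ℕ → ℕ) → ℕ → ℕ
Σ g zero    = 0
Σ g (suc m) = g 0 + Σ (λ i → g (suc i)) m

Σ-last : ∀ g m → Σ g (suc m) ≡ Σ g m + g m
Σ-last g zero    = +-comm (g 0) 0
Σ-last g (suc m) = begin
  g 0 + Σ g′ (suc m)  ≡⟨ cong (g 0 +_) (Σ-last g′ m) ⟩
  g 0 + (Σ g′ m + g′ m) ≡⟨ +-assoc (g 0) _ _ ⟨
  g 0 + Σ g′ m + g′ m   ∎
  where
  open ≡-Reasoning
  g′ : ℕ → ℕ
  g′ i = g (suc i)

sum-map-applyUpTo : ∀ (f g : ℕ → ℕ) m →
  sum (map f (applyUpTo g m)) ≡ Σ (λ i → f (g i)) m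
sum-map-applyUpTo f g zero    = refl
sum-map-applyUpTo f g (suc m) = cong (f (g 0) +_) (sum-map-applyUpTo f (λ i → g (suc i)) m)

isOne : ℕ → ℕ
isOne x = if does (x ≟ 1) then 1 else 0

length-filter-coprime : ∀ n (f : ℕ → ℕ) m →
  length (filter (λ k → gcd (suc k) n ≟ 1) (applyUpTo f m))
    ≡ Σ (λ i → isOne (gcd (suc (f i)) n)) m
length-filter-coprime n f zero = refl
length-filter-coprime n f (suc m) with does (gcd (suc (f 0)) n ≟ 1)
... | true  = cong suc (length-filter-coprime n (λ i → f (suc i)) m)
... | false = length-filter-coprime n (λ i → f (suc i)) m

reflect-suc : ∀ M i → i < M → suc (M ∸ suc i) ≡ M ∸ i
reflect-suc M i i<M = sym (+-∸-assoc 1 i<M)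

reflect-sum : ∀ M i → i < M → suc i + suc (M ∸ suc i) ≡ suc M
reflect-sum M i i<M = begin
  suc i + suc (M ∸ suc i) ≡⟨ cong (suc i +_) (reflect-suc M i i<M) ⟩
  suc (i + (M ∸ i))       ≡⟨ cong suc (m+[n∸m]≡n (<⇒≤ i<M)) ⟩
  suc M                   ∎
  where open ≡-Reasoning

Σ-paired-divisible : ∀ d h (g : ℕ → ℕ) →
  (∀ i → i < h * 2 → d ∣ g i + g (h * 2 ∸ suc i)) → d ∣ Σ g (h * 2)
Σ-paired-divisible d zero    g pairs = d ∣0
Σ-paired-divisible d (suc h) g pairs =
  subst (d ∣_) regroup (∣m∣n⇒∣m+n (pairs 0 (s≤s z≤n)) inner)
  where
  M : ℕ
  M = h * 2
  g′ : ℕ → ℕ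
  g′ i = g (suc i)
  -- the middle terms g 1 … g M again form a reflected family
  inner : d ∣ Σ g′ M
  inner = Σ-paired-divisible d h g′ λ i i<M →
    subst (λ z → d ∣ g (suc i) + g z) (sym (reflect-suc M i i<M))
      (pairs (suc i) (s≤s (m<n⇒m<1+n i<M)))
  regroup : (g 0 + g (suc M)) + Σ g′ M ≡ g 0 + Σ g′ (suc M)
  regroup = trans (+-assoc (g 0) _ _)
    (cong (g 0 +_) (trans (+-comm (g (suc M)) _) (sym (Σ-last g′ M))))

-- a + b divides a^(2t+1) + b^(2t+1), by induction on t using
-- (a + b)(a X + b Y) = a b (X + Y) + (a² X + b² Y).
odd-power-sum-divisible : ∀ a b t → a + b ∣ a ^ suc (t * 2) + b ^ suc (t * 2)
odd-power-sum-divisible a b zero =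
  ∣-reflexive (sym (cong₂ _+_ (*-identityʳ a) (*-identityʳ b)))
odd-power-sum-divisible a b (suc t) =
  ∣m+n∣m⇒∣n (subst (a + b ∣_) (expand a b X Y) (m∣m*n _))
    (∣n⇒∣m*n (a * b) (odd-power-sum-divisible a b t))
  where
  open +-*-Solver
  X Y : ℕ
  X = a ^ suc (t * 2)
  Y = b ^ suc (t * 2)
  expand : ∀ a b X Y →
    (a + b) * (a * X + b * Y) ≡ a * b * (X + Y) + (a * (a * X) + b * (b * Y))
  expand = solve 4 (λ a b X Y → (a :+ b) :* (a :* X :+ b :* Y) :=
    a :* b :* (X :+ Y) :+ (a :* (a :* X) :+ b :* (b :* Y))) refl

parity : ∀ x → 2 ∣ x ⊎ OddWitness x
parity zero          = inj₁ (2 ∣0)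
parity (suc zero)    = inj₂ (0 , refl)
parity (suc (suc x)) with parity x
... | inj₁ (divides q eq) = inj₁ (divides (suc q) (cong (λ z → suc (suc z)) eq))
... | inj₂ (t , eq)       = inj₂ (suc t , cong (λ z → suc (suc z)) eq)

Odd⇒¬2∣ : ∀ x → Odd x → ¬ (2 ∣ x)
Odd⇒¬2∣ x odd 2∣x with trans (sym odd) (n∣m⇒m%n≡0 x 2 2∣x)
... | ()

Odd⇒OddWitness : ∀ x → Odd x → OddWitness x
Odd⇒OddWitness x odd with parity x
... | inj₁ 2∣x = ⊥-elim (Odd⇒¬2∣ x odd 2∣x)
... | inj₂ w   = w

odd-gcd-with-even : ∀ k X → 2 ∣ X → Odd (gcd k X) → OddWitness k
odd-gcd-with-even k X 2∣X odd with parity k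
... | inj₂ w   = w
... | inj₁ 2∣k = ⊥-elim (Odd⇒¬2∣ _ odd (gcd-greatest 2∣k 2∣X))

gcd-complement : ∀ a b n → a + b ≡ n → gcd a n ≡ gcd b n
gcd-complement a b n a+b≡n =
  ∣-antisym (divides-other a b n a+b≡n) (divides-other b a n (trans (+-comm b a) a+b≡n))
  where
  divides-other : ∀ a b n → a + b ≡ n → gcd a n ∣ gcd b n
  divides-other a b n e = gcd-greatest
    (∣m+n∣m⇒∣n (subst (gcd a n ∣_) (sym e) (gcd[m,n]∣n a n)) (gcd[m,n]∣m a n))
    (gcd[m,n]∣n a n)

gcd-self : ∀ n → gcd n n ≡ n
gcd-self n = ∣-antisym (gcd[m,n]∣m n n) (gcd-greatest ∣-refl ∣-refl)

-- φ(n) is even for odd n = 2(h+1) + 1 ≥ 3: the residues 1 … n - 1 pair up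
-- as j, n - j with equal coprimality, and n itself is not coprime to n.
φ-even : ∀ h → 2 ∣ φ (suc (suc h * 2))
φ-even h = subst (2 ∣_) (sym φ-as-Σ) (Σ-paired-divisible 2 (suc h) coprimeTo paired)
  where
  n M : ℕ
  n = suc (suc h * 2)
  M = suc h * 2
  coprimeTo : ℕ → ℕ
  coprimeTo i = isOne (gcd (suc i) n)
  n-not-coprime : coprimeTo M ≡ 0
  n-not-coprime rewrite gcd-self n = refl
  φ-as-Σ : φ n ≡ Σ coprimeTo M
  φ-as-Σ = begin
    φ n                          ≡⟨ length-filter-coprime n (λ i → i) n ⟩
    Σ coprimeTo (suc M)          ≡⟨ Σ-last coprimeTo M ⟩
    Σ coprimeTo M + coprimeTo M  ≡⟨ cong (Σ coprimeTo M +_) n-not-coprime ⟩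
    Σ coprimeTo M + 0            ≡⟨ +-identityʳ _ ⟩
    Σ coprimeTo M                ∎
    where open ≡-Reasoning
  paired : ∀ i → i < M → 2 ∣ coprimeTo i + coprimeTo (M ∸ suc i)
  paired i i<M = subst (λ z → 2 ∣ coprimeTo i + z)
    (cong isOne (gcd-complement (suc i) (suc (M ∸ suc i)) n (reflect-sum M i i<M)))
    (divides (coprimeTo i) (x+x≡x*2 (coprimeTo i)))
    where
    x+x≡x*2 : ∀ x → x + x ≡ x * 2
    x+x≡x*2 x = trans (cong (x +_) (sym (+-identityʳ x))) (*-comm 2 x)

-- For n = a + 1 ≥ 3, every m with a^m ≡ 1 for all units a is even:
-- a ≡ -1 is a unit, and for odd m, n ∣ a^m + 1 and n ∣ a^m - 1 give n ∣ 2.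
annihilator-even : ∀ a m → 2 ≤ a → AnnihilatesUnits (suc a) m → 2 ∣ m
annihilator-even a m 2≤a annihilates with parity m
... | inj₁ 2∣m = 2∣m
... | inj₂ (t , refl) = ⊥-elim (<⇒≱ (s≤s 2≤a) (∣⇒≤ n∣2))
  where
  n P : ℕ
  n = suc a
  P = a ^ suc (t * 2)
  a-unit : Coprime a n
  a-unit {d} (d∣a , d∣n) = ∣1⇒≡1 (∣m+n∣m⇒∣n {m = a} (subst (d ∣_) (+-comm 1 a) d∣n) d∣a)
  n∣P∸1 : n ∣ P ∸ 1
  n∣P∸1 = annihilates a a-unit
  n∣P+1 : n ∣ P + 1
  n∣P+1 = subst₂ _∣_ (+-comm a 1) (cong (P +_) (^-zeroˡ (suc (t * 2))))
    (odd-power-sum-divisible a 1 t)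
  P∸1+2 : (P ∸ 1) + 2 ≡ P + 1
  P∸1+2 = trans (sym (+-∸-comm 2 (m^n>0 a ⦃ >-nonZero (≤-trans (s≤s z≤n) 2≤a) ⦄ (suc (t * 2)))))
    (trans (cong (_∸ 1) (+-comm P 2)) (+-comm 1 P))
  n∣2 : n ∣ 2
  n∣2 = ∣m+n∣m⇒∣n (subst (n ∣_) (sym P∸1+2) n∣P+1) n∣P∸1

G-divisible : ∀ k → OddWitness k → suc (k * 2) ∣ G (suc (k * 2))
G-divisible k (t , k≡2t+1) =
  subst (suc (k * 2) ∣_) (sym G-as-Σ) (Σ-paired-divisible _ k power paired)
  where
  M : ℕ
  M = k * 2
  power : ℕ → ℕ
  power i = suc i ^ suc (t * 2)
  G-as-Σ : G (suc M) ≡ Σ power M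
  G-as-Σ = trans (sum-map-applyUpTo (λ j → j ^ (M / 2)) suc M)
    (cong (λ e → Σ (λ i → suc i ^ e) M) (trans (m*n/n≡m k 2) k≡2t+1))
  paired : ∀ i → i < M → suc M ∣ power i + power (M ∸ suc i)
  paired i i<M = subst (_∣ power i + power (M ∸ suc i)) (reflect-sum M i i<M)
    (odd-power-sum-divisible (suc i) (suc (M ∸ suc i)) t)

half-odd : ∀ k → let n = suc (suc k * 2) in
  Odd (gcd (suc k) (φ n)) ⊎ ∃ (λ m → IsCarmichaelλ n m × Odd (gcd (suc k) m)) →
  OddWitness (suc k)
half-odd k (inj₁ odd-gcd-φ) = odd-gcd-with-even (suc k) _ (φ-even k) odd-gcd-φ
half-odd k (inj₂ (m , (_ , annihilates , _) , odd-gcd-λ)) =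
  odd-gcd-with-even (suc k) m (annihilator-even (suc k * 2) m (s≤s (s≤s z≤n)) annihilates) odd-gcd-λ

mainTheorem6 : (n : ℕ) → 1 ≤ n → Odd n →
    (Odd (gcd ((n ∸ 1) / 2) (φ n))
      ⊎ ∃ (λ m → IsCarmichaelλ n m × Odd (gcd ((n ∸ 1) / 2) m))) →
    InP n
mainTheorem6 n 1≤n odd hyp with Odd⇒OddWitness n odd
... | zero , refl = 1≤n , odd , 1∣ _
... | suc k , refl = 1≤n , odd , G-divisible (suc k) (half-odd k hyp′)
  where
  hyp′ : Odd (gcd (suc k) (φ n)) ⊎ ∃ (λ m → IsCarmichaelλ n m × Odd (gcd (suc k) m))
  hyp′ = subst (λ h → Odd (gcd h (φ n)) ⊎ ∃ (λ m → IsCarmichaelλ n m × Odd (gcd h m)))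
    (m*n/n≡m (suc k) 2) hyp
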